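{- Let $f:\mathbf L\to\mathbf M$ be a homomorphism of De Morgan bisemilattices, and let $S(\mathbf L)$, $S(\mathbf M)$ be the associated 2spaces$^\star$. Then $S(f)=(f^{ -1},f^{ -1}):S(\mathbf M)\to S(\mathbf L)$ is a 2space$^\star$ morphism. Here the components take preimages under $f$ of filters and of ideals of $\mathbf M$.
   Context: **Bisemilattices.** A De Morgan bisemilattice is an algebra $\langle A,\land,\lor,',0,1\rangle$ such that: - $\land,\lor$ are idempotent, commutative and associative, and each distributes over the other; - $x\land1=x$, $x\lor0=x$, $x''=x$, $(x\land y)'=x'\lor y'$ and $(x\lor y)'=x'\land y'$. Homomorphisms preserve $\land,\lor,',0,1$. Write $a\le_\land b$ iff $a\land b=a$, and $a\le_\lor b$ iff $a\lor b=b$. Filters are nonempty subsets upward closed for $\le_\land$ and closed under $\land$; ideals are nonempty subsets downward closed for $\le_\lor$ and closed under $\lor$. **Fspaces.** An Fspace is a Stone space $X$ with a partial order $\le$ such that: (1) every subset has a greatest lower bound; (2) there is a clopen subbasis $\{X_i\}\cup\{\overline X_i\}$, where $X_i=\{x:x_i\le x\}$ for points $x_i$ and $\overline X_i=X\setminus X_i$; (3) every $x$ is the least upper bound of $\{x_i:x_i\le x\}$; (4) $X^*=\{X_i\}$ is closed under finite intersections. Put $\overline X^*=\{\overline X_i\}$. An Fspace morphism $f:Y\to X$ is continuous, preserves greatest lower bounds, and satisfies $f^{ -1}(U)\in Y^*$ for $U\in X^*$. **2spaces and 2spaces$^\star$.** A 2space $\langle X,\rho,Y\rangle$ consists of: -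 Fspaces $X,Y$ with subbases $\{X_a\}\cup\{\overline X_a\}$ and $\{Y_a\}\cup\{\overline Y_a\}$ over a common index set; - a bijection $\rho:X^*\to\overline Y^*$ with $\rho(X_a)=\overline Y_a$, satisfying $P\cap\rho^{ -1}(\rho(Q)\cup\rho(R))=\rho^{ -1}(\rho(P\cap Q)\cup\rho(P\cap R))$ for $P,Q,R\in X^*$, and $P\cup\rho(\rho^{ -1}(Q)\cap\rho^{ -1}(R))=\rho(\rho^{ -1}(P\cup Q)\cap\rho^{ -1}(P\cup R))$ for $P,Q,R\in\overline Y^*$. A 2space$^\star$ adds an inclusion-reversing order isomorphism ${}^\star:\overline Y^*\to X^*$ with ${}^\star\circ\rho=\rho^{ -1}\circ({}^\star)^{ -1}$, with $\overline Y^*$ having a least element $\overline0$. A 2space$^\star$ morphism from $\langle X,\rho,{}^{\star_Y},Y\rangle$ to $\langle Z,\sigma,{}^{\star_W},W\rangle$ is a pair $(\psi,\chi)$ of Fspace morphisms $\psi:X\to Z$, $\chi:Y\to W$ such that, for all $U\in Z^*$: $\psi^{ -1}(U)=\rho^{ -1}(\chi^{ -1}(\sigma(U)))$ and $\chi^{ -1}(U^{\star_W^{ -1}})=(\psi^{ -1}(U))^{\star_Y^{ -1}}$. **$S(\mathbf L)$.** $S(\mathbf L)=\langle\mathcal F(L),\rho,{}^\star,\mathcal I(L)\rangle$, where: - filters and ideals are ordered by inclusion; - the subbases are $X_a=\{F:a\in F\}$, $Y_a=\{I:a\in I\}$ and their complements; - $\rho(X_a)=\overline Y_a$, $(\overline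 Y_a)^\star=X_{a'}$ and $\overline0=\overline Y_0$. -}

module Defs where

open import Level using (Lift; lift; lower)
open import Data.Product using (Σ; _×_; _,_; proj₁; proj₂)
open import Data.List using (List)
open import Data.List.Relation.Unary.All using (All)
open import Data.Bool using (Bool; true; false)
open import Relation.Nullary using (¬_)
open import Relation.Binary.PropositionalEquality using (_≡_; refl; sym; trans; cong; subst)

record DMBisemilattice : Set₁ where
  infixr 7 _∧_
  infixr 6 _∨_
  infix 8 _′
  field
    Carrier : Set
    _∧_ _∨_ : Carrier → Carrier → Carrier
    _′      : Carrier → Carrier
    𝟎 𝟏     : Carrier
    ∧-idem   : ∀ x → x ∧ x ≡ x
    ∨-idem   : ∀ x → x ∨ x ≡ x
    ∧-comm   : ∀ x y → x ∧ y ≡ y ∧ x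
    ∨-comm   : ∀ x y → x ∨ y ≡ y ∨ x
    ∧-assoc  : ∀ x y z → (x ∧ y) ∧ z ≡ x ∧ (y ∧ z)
    ∨-assoc  : ∀ x y z → (x ∨ y) ∨ z ≡ x ∨ (y ∨ z)
    ∧-distrib-∨ : ∀ x y z → x ∧ (y ∨ z) ≡ (x ∧ y) ∨ (x ∧ z)
    ∨-distrib-∧ : ∀ x y z → x ∨ (y ∧ z) ≡ (x ∨ y) ∧ (x ∨ z)
    ∧-identity : ∀ x → x ∧ 𝟏 ≡ x
    ∨-identity : ∀ x → x ∨ 𝟎 ≡ x
    ′-involutive : ∀ x → (x ′) ′ ≡ x
    deMorgan-∧ : ∀ x y → (x ∧ y) ′ ≡ (x ′) ∨ (y ′)
    deMorgan-∨ : ∀ x y → (x ∨ y) ′ ≡ (x ′) ∧ (y ′)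

  _≤∧_ : Carrier → Carrier → Set
  a ≤∧ b = a ∧ b ≡ a

  _≤∨_ : Carrier → Carrier → Set
  a ≤∨ b = a ∨ b ≡ b

  record IsFilter (F : Carrier → Set) : Set where
    field
      nonempty : Σ Carrier F
      up-closed : ∀ {a b} → F a → a ≤∧ b → F b
      ∧-closed : ∀ {a b} → F a → F b → F (a ∧ b)

  record IsIdeal (I : Carrier → Set) : Set where
    field
      nonempty : Σ Carrier I
      down-closed : ∀ {a b} → I b → a ≤∨ b → I a
      ∨-closed : ∀ {a b} → I a → I b → I (a ∨ b)

open DMBisemilattice

record Homomorphism (L M : DMBisemilattice) : Set where
  field
    ⟦_⟧ : Carrier L → Carrier M
    pres-∧ : ∀ x y → ⟦ _∧_ L x y ⟧ ≡ _∧_ M ⟦ x ⟧ ⟦ y ⟧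
    pres-∨ : ∀ x y → ⟦ _∨_ L x y ⟧ ≡ _∨_ M ⟦ x ⟧ ⟦ y ⟧
    pres-′ : ∀ x → ⟦ _′ L x ⟧ ≡ _′ M ⟦ x ⟧
    pres-𝟎 : ⟦ 𝟎 L ⟧ ≡ 𝟎 M
    pres-𝟏 : ⟦ 𝟏 L ⟧ ≡ 𝟏 M

module PointSpace (A : Set) (Is : (A → Set) → Set) where
  Pt : Set₁
  Pt = Σ (A → Set) Is

  _∈ₚ_ : A → Pt → Set
  a ∈ₚ p = proj₁ p a

  _⊑_ : Pt → Pt → Set
  p ⊑ q = ∀ a → a ∈ₚ p → a ∈ₚ q

  _≈ₚ_ : Pt → Pt → Set
  p ≈ₚ q = p ⊑ q × q ⊑ p

  Subset : Set₂
  Subset = Pt → Set₁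

  _≐_ : Subset → Subset → Set₁
  U ≐ V = (∀ p → U p → V p) × (∀ p → V p → U p)

  Sub : A → Bool → Subset
  Sub a true  p = Lift _ (a ∈ₚ p)
  Sub a false p = Lift _ (¬ (a ∈ₚ p))

  X : A → Subset
  X a = Sub a true

  X̄ : A → Subset
  X̄ a = Sub a false

  InAll : List (A × Bool) → Subset
  InAll ls p = All (λ s → Sub (proj₁ s) (proj₂ s) p) ls

  Open : Subset → Set₁
  Open U = ∀ p → U p →
    Σ (List (A × Bool)) λ ls → InAll ls p × (∀ q → InAll ls q → U q)

  IsLowerBound : Subset → Pt → Set₁
  IsLowerBound S g = ∀ h → S h → g ⊑ h

  IsGlb : Subset → Pt → Set₁
  IsGlb S g = IsLowerBound S g × (∀ k → IsLowerBound S k → k ⊑ g)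

module Maps (A : Set) (IsA : (A → Set) → Set)
            (B : Set) (IsB : (B → Set) → Set) where
  private
    module SA = PointSpace A IsA
    module SB = PointSpace B IsB

  _⁻¹[_] : (SA.Pt → SB.Pt) → SB.Subset → SA.Subset
  (ψ ⁻¹[ U ]) p = U (ψ p)

  Img : (SA.Pt → SB.Pt) → SA.Subset → SB.Subset
  Img ψ S k = Σ SA.Pt λ h → S h × (k SB.≈ₚ ψ h)

  record IsFspaceMorphism (ψ : SA.Pt → SB.Pt) : Set₃ where
    field
      continuous   : ∀ U → SB.Open U → SA.Open (ψ ⁻¹[ U ])
      preservesGlb : ∀ S g → SA.IsGlb S g → SB.IsGlb (Img ψ S) (ψ g)
      pullback-X*  : ∀ b → Σ A λ a → (ψ ⁻¹[ SB.X b ]) SA.≐ SA.X a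

module Spaces (L : DMBisemilattice) where
  module F = PointSpace (Carrier L) (IsFilter L)
  module I = PointSpace (Carrier L) (IsIdeal L)

Filt : DMBisemilattice → Set₁
Filt L = PointSpace.Pt (Carrier L) (IsFilter L)

Idl : DMBisemilattice → Set₁
Idl L = PointSpace.Pt (Carrier L) (IsIdeal L)

-- 2space⋆ morphisms between S(L₁) = ⟨F(L₁),ρ,⋆,I(L₁)⟩ and
-- S(L₂) = ⟨F(L₂),σ,⋆,I(L₂)⟩, where ρ(X_a) = Ȳ_a, (Ȳ_a)⋆ = X_{a'}.

record Is2Space⋆MorphismS (L₁ L₂ : DMBisemilattice)
         (ψ : Filt L₁ → Filt L₂) (χ : Idl L₁ → Idl L₂) : Set₃ where
  private
    module F₁ = PointSpace (Carrier L₁) (IsFilter L₁)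
    module I₁ = PointSpace (Carrier L₁) (IsIdeal L₁)
    module F₂ = PointSpace (Carrier L₂) (IsFilter L₂)
    module I₂ = PointSpace (Carrier L₂) (IsIdeal L₂)
    module MF = Maps (Carrier L₁) (IsFilter L₁) (Carrier L₂) (IsFilter L₂)
    module MI = Maps (Carrier L₁) (IsIdeal L₁) (Carrier L₂) (IsIdeal L₂)
  field
    ψ-morphism : MF.IsFspaceMorphism ψ
    χ-morphism : MI.IsFspaceMorphism χ
    -- ψ⁻¹(U) = ρ⁻¹(χ⁻¹(σ(U))) for U = X_a ∈ Z*: σ(X_a) = Ȳ_a and
    -- ρ⁻¹(Ȳ_b) = X_b
    cond-ρσ : ∀ (a : Carrier L₂) → Σ (Carrier L₁) λ b →
      (χ MI.⁻¹[ I₂.X̄ a ]) I₁.≐ I₁.X̄ b × (ψ MF.⁻¹[ F₂.X a ]) F₁.≐ F₁.X b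
    -- χ⁻¹(U^{⋆⁻¹}) = (ψ⁻¹(U))^{⋆⁻¹} for U = X_a ∈ Z*:
    -- U^{⋆⁻¹} = Ȳ_c where X_{c'} = U, and (ψ⁻¹U)^{⋆⁻¹} = Ȳ_d where X_{d'} = ψ⁻¹U
    cond-⋆ : ∀ (a : Carrier L₂) → Σ (Carrier L₂) λ c → Σ (Carrier L₁) λ d →
      F₂.X (_′ L₂ c) F₂.≐ F₂.X a
      × F₁.X (_′ L₁ d) F₁.≐ (ψ MF.⁻¹[ F₂.X a ])
      × (χ MI.⁻¹[ I₂.X̄ c ]) I₁.≐ I₁.X̄ d

module _ {L M : DMBisemilattice} (f : Homomorphism L M) where
  open Homomorphism f

  preimageFilter : Filt M → Filt L
  preimageFilter (G , isF) = (λ a → G ⟦ a ⟧) , record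
    { nonempty = 𝟏 L , subst G (sym pres-𝟏)
        (up-closed (proj₂ nonempty) (∧-identity M (proj₁ nonempty)))
    ; up-closed = λ {a} {b} Ga ab → up-closed Ga
        (trans (sym (pres-∧ a b)) (cong ⟦_⟧ ab))
    ; ∧-closed = λ {a} {b} Ga Gb → subst G (sym (pres-∧ a b)) (∧-closed Ga Gb)
    }
    where open IsFilter isF

  preimageIdeal : Idl M → Idl L
  preimageIdeal (J , isI) = (λ a → J ⟦ a ⟧) , record
    { nonempty = 𝟎 L , subst J (sym pres-𝟎)
        (down-closed (proj₂ nonempty)
          (trans (∨-comm M (𝟎 M) (proj₁ nonempty)) (∨-identity M (proj₁ nonempty))))
    ; down-closed = λ {a} {b} Jb ab → down-closed Jb
        (trans (sym (pres-∨ a b)) (cong ⟦_⟧ ab))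
    ; ∨-closed = λ {a} {b} Ja Jb → subst J (sym (pres-∨ a b)) (∨-closed Ja Jb)
    }
    where open IsIdeal isI

module Submission where

-- Both components are instances of one general fact.  Let h : B → A and
-- let φ send points p (subsets of A) to points of B with
--   b ∈ φ p  ⇔  h b ∈ p                                   ("φ is induced by h").
-- Then φ pulls every subbasic set Sub b t back to Sub (h b) t, hence every
-- finite intersection of subbasic sets, so φ is continuous and pulls X* back
-- into X*.  If moreover every a ∈ A generates a least point ⟨ a ⟩ (a principal
-- filter / ideal), φ preserves greatest lower bounds: ⟨ h b ⟩ is a lower bound
-- of S whenever b lies in a lower bound of φ[S].
-- Preimage of filters and of ideals under a homomorphism are induced by f, and
-- bisemilattices have principal filters and ideals, so both components are
-- Fspace morphisms.  The two compatibility conditions with ρ and ⋆ reduce to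
-- equalities of subbasic sets indexed by equal elements (involutivity of ′ and
-- preservation of ′ by f).

open import Defs
open import Level using (lift)
open import Data.Product using (_×_; _,_; proj₁; proj₂)
open import Data.List using (List; map)
import Data.List.Relation.Unary.All as All
open import Data.List.Relation.Unary.All.Properties using (map⁺; map⁻)
open import Data.Bool using (Bool; true; false)
open import Function using (_⇔_; mk⇔; Equivalence; id)
open import Relation.Binary.PropositionalEquality using (_≡_; refl; sym; trans; cong)
open DMBisemilattice
open Equivalence

module _ {A : Set} {Is : (A → Set) → Set} where
  open PointSpace A Is

  Sub-cong : ∀ {a b} t → a ≡ b → Sub a t ≐ Sub b t
  Sub-cong t refl = (λ _ x → x) , (λ _ x → x)

  record PrincipalPoints : Set₁ where
    field
      ⟨_⟩       : A → Pt
      generator : ∀ a → a ∈ₚ ⟨ a ⟩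
      least     : ∀ a q → a ∈ₚ q → ⟨ a ⟩ ⊑ q

module Induced (A : Set) (IsA : (A → Set) → Set)
               (B : Set) (IsB : (B → Set) → Set)
               (h : B → A) (φ : PointSpace.Pt A IsA → PointSpace.Pt B IsB)
               (induced : ∀ p b → proj₁ (φ p) b ⇔ proj₁ p (h b)) where
  private
    module SA = PointSpace A IsA
    module SB = PointSpace B IsB
  open Maps A IsA B IsB

  ∈φ⇒ : ∀ {p b} → proj₁ (φ p) b → proj₁ p (h b)
  ∈φ⇒ {p} {b} = to (induced p b)

  ⇒∈φ : ∀ {p b} → proj₁ p (h b) → proj₁ (φ p) b
  ⇒∈φ {p} {b} = from (induced p b)

  sub-to : ∀ p b t → SB.Sub b t (φ p) → SA.Sub (h b) t p
  sub-to p b true  (lift x) = lift (∈φ⇒ x)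
  sub-to p b false (lift x) = lift (λ y → x (⇒∈φ y))

  sub-from : ∀ p b t → SA.Sub (h b) t p → SB.Sub b t (φ p)
  sub-from p b true  (lift x) = lift (⇒∈φ x)
  sub-from p b false (lift x) = lift (λ y → x (∈φ⇒ y))

  reindex : List (B × Bool) → List (A × Bool)
  reindex = map (λ s → h (proj₁ s) , proj₂ s)

  inAll-to : ∀ p ls → SB.InAll ls (φ p) → SA.InAll (reindex ls) p
  inAll-to p ls xs = map⁺ (All.map (λ {s} → sub-to p (proj₁ s) (proj₂ s)) xs)

  inAll-from : ∀ p ls → SA.InAll (reindex ls) p → SB.InAll ls (φ p)
  inAll-from p ls xs = All.map (λ {s} → sub-from p (proj₁ s) (proj₂ s)) (map⁻ xs)

  continuous : ∀ U → SB.Open U → SA.Open (φ ⁻¹[ U ])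
  continuous U open-U p Uφp =
    let (ls , p∈ls , ls⊆U) = open-U (φ p) Uφp
    in reindex ls , inAll-to p ls p∈ls , λ q q∈ls → ls⊆U (φ q) (inAll-from q ls q∈ls)

  -- With principal points in A, φ maps a glb of S to a glb of φ[S]:
  -- if b lies in a lower bound of φ[S], then ⟨ h b ⟩ is a lower bound of S.
  preservesGlb : PrincipalPoints {A} {IsA} →
                 ∀ S g → SA.IsGlb S g → SB.IsGlb (Img φ S) (φ g)
  preservesGlb P S g (g-lower , g-greatest) = φg-lower , φg-greatest
    where
    open PrincipalPoints P

    φg-lower : SB.IsLowerBound (Img φ S) (φ g)
    φg-lower k (q , Sq , (_ , φq⊑k)) b b∈φg =
      φq⊑k b (⇒∈φ (g-lower q Sq (h b) (∈φ⇒ b∈φg)))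

    φg-greatest : ∀ k → SB.IsLowerBound (Img φ S) k → k SB.⊑ φ g
    φg-greatest k k-lower b b∈k = ⇒∈φ (g-greatest ⟨ h b ⟩ hb-lower (h b) (generator (h b)))
      where
      hb-lower : SA.IsLowerBound S ⟨ h b ⟩
      hb-lower q Sq = least (h b) q
        (∈φ⇒ (k-lower (φ q) (q , Sq , ((λ _ x → x) , (λ _ x → x))) b b∈k))

  isFspaceMorphism : PrincipalPoints {A} {IsA} → IsFspaceMorphism φ
  isFspaceMorphism P = record
    { continuous   = continuous
    ; preservesGlb = preservesGlb P
    ; pullback-X*  = λ b → h b , (λ p → sub-to p b true) , (λ p → sub-from p b true)
    }

module Principal (M : DMBisemilattice) where
  private
    _∧M_ = _∧_ M
    _∨M_ = _∨_ M

  principalFilters : PrincipalPoints {Carrier M} {IsFilter M}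
  principalFilters = record
    { ⟨_⟩       = λ c → (λ x → c ∧M x ≡ c) , record
        { nonempty  = c , ∧-idem M c
        ; up-closed = λ {x} {y} cx xy →
            trans (cong (_∧M y) (sym cx)) (trans (∧-assoc M c x y) (trans (cong (c ∧M_) xy) cx))
        ; ∧-closed  = λ {x} {y} cx cy → trans (sym (∧-assoc M c x y)) (trans (cong (_∧M y) cx) cy)
        }
    ; generator = ∧-idem M
    ; least     = λ c q qc x cx → IsFilter.up-closed (proj₂ q) qc cx
    }

  principalIdeals : PrincipalPoints {Carrier M} {IsIdeal M}
  principalIdeals = record
    { ⟨_⟩       = λ c → (λ x → x ∨M c ≡ c) , record
        { nonempty    = c , ∨-idem M c
        ; down-closed = λ {x} {y} yc xy →
            trans (cong (x ∨M_) (sym yc)) (trans (sym (∨-assoc M x y c)) (trans (cong (_∨M c) xy) yc))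
        ; ∨-closed    = λ {x} {y} xc yc → trans (∨-assoc M x y c) (trans (cong (x ∨M_) yc) xc)
        }
    ; generator = ∨-idem M
    ; least     = λ c q qc x xc → IsIdeal.down-closed (proj₂ q) qc xc
    }

lemma7p6 : (L M : DMBisemilattice) (f : Homomorphism L M) →
    Is2Space⋆MorphismS M L (preimageFilter f) (preimageIdeal f)
lemma7p6 L M f = record
  { ψ-morphism = Induced.isFspaceMorphism (Carrier M) (IsFilter M) (Carrier L) (IsFilter L)
      ⟦_⟧ (preimageFilter f) (λ _ _ → mk⇔ id id) principalFilters
  ; χ-morphism = Induced.isFspaceMorphism (Carrier M) (IsIdeal M) (Carrier L) (IsIdeal L)
      ⟦_⟧ (preimageIdeal f) (λ _ _ → mk⇔ id id) principalIdeals
  ; cond-ρσ = λ a → ⟦ a ⟧ , Sub-cong false refl , Sub-cong true refl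
  -- take c = a′ and d = (f a)′; then X_{c′} = X_a, X_{d′} = X_{f a} and
  -- f⁻¹(Ȳ_{a′}) = Ȳ_{f(a′)} = Ȳ_{(f a)′}
  ; cond-⋆ = λ a → _′ L a , _′ M ⟦ a ⟧
      , Sub-cong true (′-involutive L a)
      , Sub-cong true (′-involutive M ⟦ a ⟧)
      , Sub-cong false (pres-′ a)
  }
  where
  open Homomorphism f
  open Principal M
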